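{- For all natural numbers $n, k$ with $n \geq k \geq 0$, the positive rational number $$\left[\begin{array}{c} n \\ k \end{array}\right] := \frac{\mathrm{lcm}(n, n-1, \dots, n-k+1)}{\mathrm{lcm}(1, 2, \dots, k)}$$ is an integer.
   Context: The least common multiple of the empty set is taken to be $1$ (so the expression equals $1$ when $k=0$). $\mathbb{N}$ denotes the set of nonnegative integers. -}

module Defs where

open import Data.Nat using (ℕ; zero; suc; _∸_; _+_)
open import Data.Nat.LCM using (lcm)

lcmUpTo : ℕ → (ℕ → ℕ) → ℕ
lcmUpTo zero    f = 1
lcmUpTo (suc k) f = lcm (f k) (lcmUpTo k f)

fallingLcm : ℕ → ℕ → ℕ
fallingLcm n k = lcmUpTo k (λ i → n ∸ i)

lcmRange : ℕ → ℕ
lcmRange k = lcmUpTo k (λ i → suc i)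

-- Every j with 1 ≤ j ≤ k divides n ∸ (n % j), which is one of the terms n, n ∸ 1, ..., n ∸ (k ∸ 1)
-- because n % j < j ≤ k. Hence lcm(1, ..., k) divides lcm(n, ..., n ∸ k + 1).
{-# OPTIONS --safe #-}
module Submission where

open import Defs
open import Data.Nat using (ℕ; suc; _+_; _*_; _≤_; _<_; _∸_; s≤s⁻¹)
open import Data.Nat.Divisibility using (_∣_; divides; ∣-trans; 1∣_)
open import Data.Nat.DivMod using (_%_; _/_; m%n<n; m≡m%n+[m/n]*n)
open import Data.Nat.LCM using (lcm-least; m∣lcm[m,n]; n∣lcm[m,n])
open import Data.Nat.Properties using (≤-refl; m+n∸m≡n; m≤n⇒m≤1+n; m≤n⇒m<n∨m≡n; <-≤-trans)
open import Data.Sum using (inj₁; inj₂)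
open import Relation.Binary.PropositionalEquality using (refl; cong)
open Relation.Binary.PropositionalEquality.≡-Reasoning

lcmUpTo-least : ∀ {m} k (f : ℕ → ℕ) → (∀ i → i < k → f i ∣ m) → lcmUpTo k f ∣ m
lcmUpTo-least {m} 0       f f∣m = 1∣ m
lcmUpTo-least     (suc k) f f∣m =
  lcm-least (f∣m k ≤-refl) (lcmUpTo-least k f (λ i i<k → f∣m i (m≤n⇒m≤1+n i<k)))

f[i]∣lcmUpTo : ∀ k (f : ℕ → ℕ) {i} → i < suc k → f i ∣ lcmUpTo (suc k) f
f[i]∣lcmUpTo k f i<1+k with m≤n⇒m<n∨m≡n (s≤s⁻¹ i<1+k)
... | inj₂ refl = m∣lcm[m,n] (f k) _
f[i]∣lcmUpTo (suc k) f i<1+k | inj₁ i<k =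
  ∣-trans (f[i]∣lcmUpTo k f i<k) (n∣lcm[m,n] (f (suc k)) _)

1+j∣m∸m%[1+j] : ∀ m j → suc j ∣ m ∸ m % suc j
1+j∣m∸m%[1+j] m j = divides (m / suc j) (begin
  m ∸ m % suc j                               ≡⟨ cong (_∸ m % suc j) (m≡m%n+[m/n]*n m (suc j)) ⟩
  m % suc j + m / suc j * suc j ∸ m % suc j   ≡⟨ m+n∸m≡n (m % suc j) _ ⟩
  m / suc j * suc j                           ∎)

1+j∣fallingLcm : ∀ n {j k} → j < k → suc j ∣ fallingLcm n k
1+j∣fallingLcm n {j} {suc k} j<k =
  ∣-trans (1+j∣m∸m%[1+j] n j) (f[i]∣lcmUpTo k (n ∸_) (<-≤-trans (m%n<n n (suc j)) j<k))

proposition1 : ∀ (n k : ℕ) → k ≤ n → lcmRange k ∣ fallingLcm n k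
proposition1 n k _ = lcmUpTo-least k suc (λ j j<k → 1+j∣fallingLcm n j<k)
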